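{- Let $t \ge 3$ be an integer and let $T$ be a tree. Then $M_t(T)$ is not a distance magic graph.
   Context: For a graph $G=(V,E)$ and an integer $t \ge 1$, the generalised Mycielskian $M_t(G)$ is the graph with vertex set $(V \times \{0,1,\dots,t-1\}) \cup \{u\}$ (where $u$ is a new vertex), whose edges are: $(x,0)(y,0)$ for every edge $xy \in E$; $(x,i)(y,i+1)$ for every $0 \le i \le t-2$ and every ordered pair $(x,y)$ with $xy \in E$; and $(x,t-1)u$ for every $x \in V$. A graph $H$ on $N$ vertices is distance magic if there is a bijection $f: V(H) \to \{1,2,\dots,N\}$ and a constant $k$ such that for every vertex $v$, $\sum_{w \in N(v)} f(w) = k$, where $N(v)$ is the open neighbourhood of $v$. -}

module Defs where

open import Data.Nat using (ℕ; zero; suc; _+_; _*_; _≤_)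
open import Data.Fin using (Fin; toℕ; remQuot)
import Data.Fin as Fin
open import Data.Bool using (Bool; true; false; if_then_else_; _∧_; _∨_)
open import Data.List using (List; []; _∷_; map; allFin; length)
open import Data.Nat.ListAction using (sum)
open import Data.List.Relation.Unary.Unique.Propositional using (Unique)
open import Data.Product using (_×_; _,_; Σ; ∃)
open import Relation.Binary.PropositionalEquality using (_≡_)
open import Function.Bundles using (_⤖_; Bijection)

record Graph (n : ℕ) : Set where
  field
    adj   : Fin n → Fin n → Bool
    sym   : ∀ x y → adj x y ≡ adj y x
    irref : ∀ x → adj x x ≡ false
open Graph public

Adj : ∀ {n} → Graph n → Fin n → Fin n → Set
Adj G x y = adj G x y ≡ true

-- Walk from x to y given as the list of vertices visited after x
-- (consecutive vertices adjacent, last vertex is y).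
data Walk {n} (G : Graph n) : Fin n → Fin n → List (Fin n) → Set where
  here : ∀ {x} → Walk G x x []
  step : ∀ {x y z vs} → Adj G x y → Walk G y z vs → Walk G x z (y ∷ vs)

Connected : ∀ {n} → Graph n → Set
Connected {n} G = ∀ (x y : Fin n) → ∃ λ vs → Walk G x y vs

-- A cycle: vertices x ∷ vs, all distinct, at least 3 of them, consecutive ones
-- adjacent, and the last one adjacent to x (closed walk x → … → x through vs).
HasCycle : ∀ {n} → Graph n → Set
HasCycle {n} G =
  Σ (Fin n) λ x → Σ (List (Fin n)) λ vs → Σ (Fin n) λ z →
    Walk G x z vs × Adj G z x × Unique (x ∷ vs) × (2 ≤ length vs)

Acyclic : ∀ {n} → Graph n → Set
Acyclic G = HasCycle G → Data.Empty.⊥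
  where import Data.Empty

IsTree : ∀ {n} → Graph n → Set
IsTree {n} G = (1 ≤ n) × Connected G × Acyclic G

open import Data.Nat using (_≡ᵇ_)

levelAdj : ℕ → ℕ → Bool
levelAdj i j = ((i ≡ᵇ 0) ∧ (j ≡ᵇ 0)) ∨ (j ≡ᵇ suc i) ∨ (i ≡ᵇ suc j)

-- Adjacency of the generalised Mycielskian M_t(G) on the vertex set
-- Fin (1 + n * t):  zero is the apex u, and  suc k  is the pair (x , i)
-- with (x , i) = remQuot {n} t k, x : Fin n, i : Fin t.
mycAdj : ∀ {n} (t : ℕ) → Graph n → Fin (suc (n * t)) → Fin (suc (n * t)) → Bool
mycAdj {n} t G Fin.zero Fin.zero = false
mycAdj {n} t G Fin.zero (Fin.suc k) with remQuot {n} t k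
... | (x , i) = suc (toℕ i) ≡ᵇ t
mycAdj {n} t G (Fin.suc k) Fin.zero with remQuot {n} t k
... | (x , i) = suc (toℕ i) ≡ᵇ t
mycAdj {n} t G (Fin.suc k) (Fin.suc l) with remQuot {n} t k | remQuot {n} t l
... | (x , i) | (y , j) = adj G x y ∧ levelAdj (toℕ i) (toℕ j)

nbrSum : ∀ {N} → (Fin N → Fin N → Bool) → (Fin N → ℕ) → Fin N → ℕ
nbrSum {N} A f v = sum (map (λ w → if A v w then f w else 0) (allFin N))

-- Distance magic: a bijection  V → {1,…,N}  (encoded as a bijection
-- λ : Fin N ⤖ Fin N, label w = 1 + toℕ (λ w)) with constant neighbour sums.
DistanceMagic : ∀ {N} → (Fin N → Fin N → Bool) → Set
DistanceMagic {N} A =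
  Σ (Fin N ⤖ Fin N) λ λ' → Σ ℕ λ k →
    ∀ v → nbrSum A (λ w → suc (toℕ (Bijection.to λ' w))) v ≡ k

-- A nonempty acyclic graph has a vertex x of degree at most one (the end of a
-- maximal path). If x is isolated, the neighbourhood of (x,0) in M_t(G) is
-- empty while that of the apex is not, so no neighbour sum is constant. If x
-- is a leaf with neighbour y, then (x,0) and (x,1) have the neighbourhoods
-- {(y,0),(y,1)} and {(y,0),(y,2)} (this needs t ≥ 3), so equal neighbour sums
-- force (y,1) and (y,2) to carry the same label.
module Submission where

open import Defs hiding (sym)
open import Data.Nat using (ℕ; _≤_)
open import Relation.Nullary using (¬_)

open import Data.Nat using (zero; suc; _+_; _*_; _≡ᵇ_; z≤n; s≤s)
import Data.Nat.ListAction as List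
import Data.Nat.Properties as NP
open import Algebra.Properties.CommutativeMonoid.Sum NP.+-0-commutativeMonoid
  using (sum-cong-≗; sum-replicate-zero; sum-remove)
  renaming (sum to ∑)
open import Data.Bool as Bool using (Bool; true; false; if_then_else_; _∧_)
import Data.Bool.Properties as BoolP
open import Data.Empty using (⊥-elim)
open import Data.Fin as Fin using (Fin; zero; suc; toℕ; combine; punchIn; punchOut; fromℕ)
open import Data.Fin.Patterns using (0F; 1F; 2F)
open import Data.Fin.Properties as FinP using (any?)
open import Data.List using (List; []; _∷_; _++_; map; allFin; length; lookup; tabulate)
open import Data.List.Properties using (map-tabulate)
open import Data.List.Membership.Propositional using (_∈_)
open import Data.List.Membership.Propositional.Properties using (∈-lookup)
open import Data.List.Relation.Unary.All as All using ([]; _∷_)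
open import Data.List.Relation.Unary.All.Properties using (¬Any⇒All¬; ++⁻ˡ)
open import Data.List.Relation.Unary.Any using (here; there)
open import Data.List.Relation.Unary.AllPairs using ([]; _∷_)
open import Data.List.Relation.Unary.Unique.Propositional using (Unique)
open import Data.Product using (_×_; _,_; ∃; ∃₂)
open import Data.Sum using (_⊎_; inj₁; inj₂)
open import Function using (_∘_; _⤖_; Bijection; Equivalence; case_of_)
open import Relation.Binary.PropositionalEquality
  using (_≡_; _≢_; refl; sym; trans; cong; cong₂; subst; subst₂; module ≡-Reasoning)
open import Relation.Nullary using (yes; no; contradiction)
open import Relation.Nullary.Decidable using (_×-dec_; ¬?; decidable-stable)

module _ {n : ℕ} (G : Graph n) where

  Adj-sym : ∀ {x y} → Adj G x y → Adj G y x
  Adj-sym {x} {y} x~y = trans (Graph.sym G y x) x~y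

  Adj-irrefl : ∀ {x} → ¬ Adj G x x
  Adj-irrefl {x} x~x with () ← trans (sym (irref G x)) x~x

  Isolated : Fin n → Set
  Isolated x = ∀ z → ¬ Adj G x z

  Leaf : Fin n → Fin n → Set
  Leaf x y = Adj G x y × (∀ z → Adj G x z → z ≡ y)

Unique-++⁻ˡ : ∀ {A : Set} (xs : List A) {ys} → Unique (xs ++ ys) → Unique xs
Unique-++⁻ˡ []       _        = []
Unique-++⁻ˡ (x ∷ xs) (x∉ ∷ u) = ++⁻ˡ xs x∉ ∷ Unique-++⁻ˡ xs u

Unique-lookup-injective : ∀ {A : Set} {xs : List A} → Unique xs →
                          ∀ {i j} → lookup xs i ≡ lookup xs j → i ≡ j
Unique-lookup-injective (x∉ ∷ u) {zero}  {zero}  _ = refl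
Unique-lookup-injective (x∉ ∷ u) {zero}  {suc j} e = ⊥-elim (All.lookup x∉ (∈-lookup j) e)
Unique-lookup-injective (x∉ ∷ u) {suc i} {zero}  e = ⊥-elim (All.lookup x∉ (∈-lookup i) (sym e))
Unique-lookup-injective (x∉ ∷ u) {suc i} {suc j} e = cong suc (Unique-lookup-injective u e)

Unique⇒length≤ : ∀ {n} {xs : List (Fin n)} → Unique xs → length xs ≤ n
Unique⇒length≤ u = FinP.injective⇒≤ (Unique-lookup-injective u)

module _ {n : ℕ} {G : Graph n} where

  Walk-prefix : ∀ {x s z vs} → Walk G x s vs → z ∈ vs →
                ∃₂ λ q qs → ∃ λ rest → Walk G x z (q ∷ qs) × vs ≡ q ∷ qs ++ rest
  Walk-prefix {vs = q ∷ vs} (step x~q _) (here refl) = q , [] , vs , step x~q here , refl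
  Walk-prefix (step x~q w) (there z∈vs) with Walk-prefix w z∈vs
  ... | q′ , qs , rest , w′ , refl = _ , q′ ∷ qs , rest , step x~q w′ , refl

module _ {n : ℕ} (G : Graph n) (acyclic : Acyclic G) where

  open import Data.List.Membership.DecPropositional (Fin._≟_ {n}) using (_∈?_)

  IsolatedOrLeaf : Set
  IsolatedOrLeaf = ∃ λ x → Isolated G x ⊎ ∃ (Leaf G x)

  saturated-end : ∀ {e s vs} → Walk G e s vs → Unique (e ∷ vs) →
                  (∀ z → Adj G e z → z ∈ vs) → IsolatedOrLeaf
  saturated-end {e} here _ saturated = e , inj₁ λ z e~z → case saturated z e~z of λ ()
  saturated-end {e} {vs = p ∷ vs} (step e~p w) u saturated = e , inj₂ (p , e~p , only-p)
    where
    only-p : ∀ z → Adj G e z → z ≡ p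
    only-p z e~z with saturated z e~z
    ... | here z≡p = z≡p
    ... | there z∈vs with Walk-prefix w z∈vs
    ... | q , qs , rest , p⇝z , refl = ⊥-elim (acyclic
          (e , p ∷ q ∷ qs , z , step e~p p⇝z , Adj-sym G e~z ,
           Unique-++⁻ˡ (e ∷ p ∷ q ∷ qs) u , s≤s (s≤s z≤n)))

  -- The fuel cannot run out: the path never has more than n distinct vertices.
  extend-walk : ∀ fuel {e s vs} → Walk G e s vs → Unique (e ∷ vs) →
                n ≤ length vs + fuel → IsolatedOrLeaf
  extend-walk fuel {e} {vs = vs} w u bound
    with any? (λ z → (adj G e z Bool.≟ true) ×-dec ¬? (z ∈? vs))
  ... | no saturated =
        saturated-end w u λ z e~z → decidable-stable (z ∈? vs) λ z∉vs → saturated (z , e~z , z∉vs)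
  extend-walk zero {vs = vs} w u bound | yes _ =
    ⊥-elim (NP.<⇒≱ (Unique⇒length≤ u) (subst (n ≤_) (NP.+-identityʳ (length vs)) bound))
  extend-walk (suc fuel) {e} {vs = vs} w u bound | yes (z , e~z , z∉vs) =
    extend-walk fuel (step (Adj-sym G e~z) w)
      ((z≢e ∷ ¬Any⇒All¬ vs z∉vs) ∷ u)
      (subst (n ≤_) (NP.+-suc (length vs) fuel) bound)
    where z≢e : z ≢ e
          z≢e refl = Adj-irrefl G e~z

  acyclic⇒isolatedOrLeaf : 1 ≤ n → IsolatedOrLeaf
  acyclic⇒isolatedOrLeaf (s≤s z≤n) = extend-walk n {e = zero} here ([] ∷ []) NP.≤-refl

sum-tabulate : ∀ {N} (g : Fin N → ℕ) → List.sum (tabulate g) ≡ ∑ g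
sum-tabulate {zero}  g = refl
sum-tabulate {suc N} g = cong (g zero +_) (sum-tabulate (g ∘ suc))

sum-map-allFin : ∀ {N} (g : Fin N → ℕ) → List.sum (map g (allFin N)) ≡ ∑ g
sum-map-allFin g = trans (cong List.sum (map-tabulate (λ i → i) g)) (sum-tabulate g)

∑-zero : ∀ {N} {g : Fin N → ℕ} → (∀ i → g i ≡ 0) → ∑ g ≡ 0
∑-zero {N} g≗0 = trans (sum-cong-≗ g≗0) (sum-replicate-zero N)

≤-∑ : ∀ {N} (g : Fin N → ℕ) i → g i ≤ ∑ g
≤-∑ {suc N} g i = subst (g i ≤_) (sym (sum-remove {i = i} g)) (NP.m≤m+n _ _)

∑-supported-at : ∀ {N} {g : Fin N → ℕ} i → (∀ j → j ≢ i → g j ≡ 0) → ∑ g ≡ g i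
∑-supported-at {suc N} {g} i g≗0 = begin
  ∑ g                     ≡⟨ sum-remove {i = i} g ⟩
  g i + ∑ (g ∘ punchIn i) ≡⟨ cong (g i +_) (∑-zero λ j → g≗0 (punchIn i j) (FinP.punchInᵢ≢i i j)) ⟩
  g i + 0                 ≡⟨ NP.+-identityʳ (g i) ⟩
  g i                     ∎
  where open ≡-Reasoning

∑-supported-at-two : ∀ {N} {g : Fin N → ℕ} i j → i ≢ j →
                     (∀ k → k ≢ i → k ≢ j → g k ≡ 0) → ∑ g ≡ g i + g j
∑-supported-at-two {suc N} {g} i j i≢j g≗0 = begin
  ∑ g                                ≡⟨ sum-remove {i = i} g ⟩
  g i + ∑ (g ∘ punchIn i)            ≡⟨ cong (g i +_) (∑-supported-at j′ off-j′) ⟩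
  g i + g (punchIn i j′)             ≡⟨ cong (λ k → g i + g k) (FinP.punchIn-punchOut i≢j) ⟩
  g i + g j                          ∎
  where
  open ≡-Reasoning
  j′ = punchOut i≢j
  off-j′ : ∀ k → k ≢ j′ → g (punchIn i k) ≡ 0
  off-j′ k k≢j′ = g≗0 (punchIn i k) (FinP.punchInᵢ≢i i k) λ ik≡j →
    k≢j′ (FinP.punchIn-injective i k j′ (trans ik≡j (sym (FinP.punchIn-punchOut i≢j))))

module _ {N : ℕ} (A : Fin N → Fin N → Bool) (f : Fin N → ℕ) (v : Fin N) where

  private
    term : Fin N → ℕ
    term w = if A v w then f w else 0

    term-adjacent : ∀ {w} → A v w ≡ true → term w ≡ f w
    term-adjacent v~w rewrite v~w = refl

    nbrSum≡∑ : nbrSum A f v ≡ ∑ term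
    nbrSum≡∑ = sum-map-allFin term

  nbrSum-no-neighbours : (∀ w → A v w ≡ false) → nbrSum A f v ≡ 0
  nbrSum-no-neighbours v≁ = trans nbrSum≡∑ (∑-zero λ w → cong (λ b → if b then f w else 0) (v≁ w))

  ≤-nbrSum : ∀ {w} → A v w ≡ true → f w ≤ nbrSum A f v
  ≤-nbrSum {w} v~w =
    subst₂ _≤_ (term-adjacent v~w) (sym nbrSum≡∑) (≤-∑ term w)

  nbrSum-two-neighbours : ∀ {a b} → a ≢ b → A v a ≡ true → A v b ≡ true →
                          (∀ w → A v w ≡ true → w ≡ a ⊎ w ≡ b) → nbrSum A f v ≡ f a + f b
  nbrSum-two-neighbours {a} {b} a≢b v~a v~b only-a-b = begin
    nbrSum A f v      ≡⟨ nbrSum≡∑ ⟩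
    ∑ term            ≡⟨ ∑-supported-at-two a b a≢b off-a-b ⟩
    term a + term b   ≡⟨ cong₂ _+_ (term-adjacent v~a) (term-adjacent v~b) ⟩
    f a + f b         ∎
    where
    open ≡-Reasoning
    off-a-b : ∀ w → w ≢ a → w ≢ b → term w ≡ 0
    off-a-b w w≢a w≢b with A v w in v~w
    ... | false = refl
    ... | true with only-a-b w v~w
    ...   | inj₁ w≡a = ⊥-elim (w≢a w≡a)
    ...   | inj₂ w≡b = ⊥-elim (w≢b w≡b)

label : ∀ {N} → Fin N ⤖ Fin N → Fin N → ℕ
label λ′ w = suc (toℕ (Bijection.to λ′ w))

label-injective : ∀ {N} (λ′ : Fin N ⤖ Fin N) {a b} → label λ′ a ≡ label λ′ b → a ≡ b
label-injective λ′ e = Bijection.injective λ′ (FinP.toℕ-injective (NP.suc-injective e))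

LevelNeighbourhood : ∀ {t} → Fin t → Fin t → Fin t → Set
LevelNeighbourhood i j j′ =
  j ≢ j′ × levelAdj (toℕ i) (toℕ j) ≡ true × levelAdj (toℕ i) (toℕ j′) ≡ true ×
  (∀ l → levelAdj (toℕ i) (toℕ l) ≡ true → l ≡ j ⊎ l ≡ j′)

module Mycielskian {n : ℕ} (t : ℕ) (G : Graph n) where

  Vertex : Set
  Vertex = Fin (suc (n * t))

  _~_ : Vertex → Vertex → Bool
  _~_ = mycAdj t G

  apex : Vertex
  apex = zero

  pair : Fin n → Fin t → Vertex
  pair x i = suc (combine x i)

  data View : Vertex → Set where
    apex-view : View apex
    pair-view : ∀ x i → View (pair x i)

  view : ∀ v → View v
  view zero    = apex-view
  view (suc k) = subst (View ∘ suc) (FinP.combine-remQuot {n} t k) (pair-view _ _)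

  pair-injectiveʳ : ∀ {x i j} → pair x i ≡ pair x j → i ≡ j
  pair-injectiveʳ {x} {i} {j} e = FinP.combine-injectiveʳ x i x j (FinP.suc-injective e)

  pair~pair : ∀ x i y j → pair x i ~ pair y j ≡ adj G x y ∧ levelAdj (toℕ i) (toℕ j)
  pair~pair x i y j = cong₂ (λ (x , i) (y , j) → adj G x y ∧ levelAdj (toℕ i) (toℕ j))
    (FinP.remQuot-combine x i) (FinP.remQuot-combine y j)

  pair~apex : ∀ x i → pair x i ~ apex ≡ (suc (toℕ i) ≡ᵇ t)
  pair~apex x i = cong (λ (_ , i) → suc (toℕ i) ≡ᵇ t) (FinP.remQuot-combine x i)

  apex~pair : ∀ x i → apex ~ pair x i ≡ (suc (toℕ i) ≡ᵇ t)
  apex~pair x i = cong (λ (_ , i) → suc (toℕ i) ≡ᵇ t) (FinP.remQuot-combine x i)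

  apex~pair-top : ∀ x i → suc (toℕ i) ≡ t → apex ~ pair x i ≡ true
  apex~pair-top x i top =
    trans (apex~pair x i) (Equivalence.to BoolP.T-≡ (NP.≡⇒≡ᵇ (suc (toℕ i)) t top))

  isolated-no-neighbours : ∀ {x i} → Isolated G x → (suc (toℕ i) ≡ᵇ t) ≡ false →
                           ∀ w → pair x i ~ w ≡ false
  isolated-no-neighbours {x} {i} x-isolated below-top w with view w
  ... | apex-view     = trans (pair~apex x i) below-top
  ... | pair-view z j = trans (pair~pair x i z j) (cong (_∧ _) (BoolP.¬-not (x-isolated z)))

  leaf-neighbours : ∀ {x y i} → Leaf G x y → (suc (toℕ i) ≡ᵇ t) ≡ false →
                    ∀ w → pair x i ~ w ≡ true →
                    ∃ λ j → w ≡ pair y j × levelAdj (toℕ i) (toℕ j) ≡ true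
  leaf-neighbours {x} {y} {i} (_ , only-y) below-top w xi~w with view w
  ... | apex-view with () ← trans (sym xi~w) (trans (pair~apex x i) below-top)
  ... | pair-view z j with adj G x z in x~z | trans (sym (pair~pair x i z j)) xi~w
  ...   | true | i-j = j , cong (λ z → pair z j) (only-y z x~z) , i-j

  leaf-nbrSum : ∀ (f : Vertex → ℕ) {x y} → Leaf G x y → ∀ {i j j′} →
                (suc (toℕ i) ≡ᵇ t) ≡ false → LevelNeighbourhood i j j′ →
                nbrSum _~_ f (pair x i) ≡ f (pair y j) + f (pair y j′)
  leaf-nbrSum f {x} {y} leaf@(x~y , _) {i} {j} {j′} below-top (j≢j′ , i-j , i-j′ , only-j-j′) =
    nbrSum-two-neighbours _~_ f (pair x i) (j≢j′ ∘ pair-injectiveʳ)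
      (pair-adjacent i-j) (pair-adjacent i-j′) only-pairs
    where
    pair-adjacent : ∀ {l} → levelAdj (toℕ i) (toℕ l) ≡ true → pair x i ~ pair y l ≡ true
    pair-adjacent {l} i-l = trans (pair~pair x i y l) (cong₂ _∧_ x~y i-l)
    only-pairs : ∀ w → pair x i ~ w ≡ true → w ≡ pair y j ⊎ w ≡ pair y j′
    only-pairs w xi~w with leaf-neighbours leaf below-top w xi~w
    ... | l , refl , i-l with only-j-j′ l i-l
    ...   | inj₁ refl = inj₁ refl
    ...   | inj₂ refl = inj₂ refl

isolated⇒¬distanceMagic : ∀ s {n} (G : Graph n) {x} → Isolated G x →
                          ¬ DistanceMagic (mycAdj (2 + s) G)
isolated⇒¬distanceMagic s G {x} x-isolated (λ′ , k , magic) =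
  contradiction (subst (1 ≤_) k≡0 1≤k) λ ()
  where
  open Mycielskian (2 + s) G
  f = label λ′
  top : Fin (2 + s)
  top = fromℕ (suc s)
  k≡0 : k ≡ 0
  k≡0 = trans (sym (magic (pair x 0F)))
          (nbrSum-no-neighbours _~_ f (pair x 0F) (isolated-no-neighbours x-isolated refl))
  apex~top : apex ~ pair x top ≡ true
  apex~top = apex~pair-top x top (cong suc (FinP.toℕ-fromℕ (suc s)))
  1≤k : 1 ≤ k
  1≤k = subst (1 ≤_) (magic apex) (NP.≤-trans (s≤s z≤n) (≤-nbrSum _~_ f apex {pair x top} apex~top))

level-0-neighbourhood : ∀ {s} → LevelNeighbourhood {3 + s} 0F 0F 1F
level-0-neighbourhood = (λ ()) , refl , refl , λ { 0F _ → inj₁ refl ; 1F _ → inj₂ refl }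

level-1-neighbourhood : ∀ {s} → LevelNeighbourhood {3 + s} 1F 0F 2F
level-1-neighbourhood = (λ ()) , refl , refl , λ { 0F _ → inj₁ refl ; 2F _ → inj₂ refl }

leaf⇒¬distanceMagic : ∀ s {n} (G : Graph n) {x y} → Leaf G x y →
                      ¬ DistanceMagic (mycAdj (3 + s) G)
leaf⇒¬distanceMagic s G {x} {y} leaf (λ′ , k , magic) =
  contradiction (pair-injectiveʳ (label-injective λ′ f-y1≡f-y2)) λ ()
  where
  open Mycielskian (3 + s) G
  open ≡-Reasoning
  f = label λ′
  f-y1≡f-y2 : f (pair y 1F) ≡ f (pair y 2F)
  f-y1≡f-y2 = NP.+-cancelˡ-≡ (f (pair y 0F)) _ _ (begin
    f (pair y 0F) + f (pair y 1F) ≡⟨ leaf-nbrSum f leaf refl level-0-neighbourhood ⟨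
    nbrSum _~_ f (pair x 0F)      ≡⟨ magic (pair x 0F) ⟩
    k                             ≡⟨ magic (pair x 1F) ⟨
    nbrSum _~_ f (pair x 1F)      ≡⟨ leaf-nbrSum f leaf refl level-1-neighbourhood ⟩
    f (pair y 0F) + f (pair y 2F) ∎)

corollary2p4 : ∀ (t : ℕ) → 3 ≤ t → ∀ {n} (T : Graph n) → IsTree T →
    ¬ DistanceMagic (mycAdj t T)
corollary2p4 (suc (suc (suc s))) (s≤s (s≤s (s≤s _))) T (nonempty , _ , acyclic)
  with acyclic⇒isolatedOrLeaf T acyclic nonempty
... | x , inj₁ x-isolated   = isolated⇒¬distanceMagic (suc s) T x-isolated
... | x , inj₂ (y , x-leaf) = leaf⇒¬distanceMagic s T x-leaf
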